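{- Let $\mathbf{A}$ be a tense DRL-algebra. For a tense filter $D$ of $\mathbf{A}$ let $S_D=D\cap C(A)$, and for a tense filter $S$ of $C(\mathbf{A})$ let $D_S=\{u\in A:u\vee c\in S\text{ and }c\Rightarrow u\in S\}$. Then the assignments $D\mapsto S_D$ and $S\mapsto D_S$ establish mutually inverse poset isomorphisms between $\mathrm{tFi}(\mathbf{A})$ and $\mathrm{tFi}(C(\mathbf{A}))$.
   Context: A DRL-algebra is a structure $\langle A,\vee,\wedge,\ast,\sim,c,0,1\rangle$ such that, with $x\Rightarrow y:=\sim(x\ast(\sim y))$, $\langle A,\vee,\wedge,\ast,\Rightarrow,0,1\rangle$ is an integral commutative residuated lattice, $\sim$ is an involutive dual lattice automorphism, $\sim c=c$, and $(x\ast y)\wedge c=((x\wedge c)\ast y)\vee(x\ast(y\wedge c))$. A tense DRL-algebra is a DRL-algebra with unary $G,H$ such that, with $F(x):=\sim G(\sim x)$, $P(x):=\sim H(\sim x)$: (t0) $G(1)=H(1)=1$; (t1) $G(c)=H(c)=c$; (t2) $G,H$ preserve $\wedge$; (t3) $x\le GP(x)$, $x\le HF(x)$; (t4) $G(x\vee y)\le G(x)\vee F(y)$, $H(x\vee y)\le H(x)\vee P(y)$; (t5) $G(x\Rightarrow y)\le G(x)\Rightarrow G(y)$, $H(x\Rightarrow y)\le H(x)\Rightarrow H(y)$. A tense filter of $\mathbf{A}$ is a nonempty up-set closed under $\ast$, $G$ and $H$; $\mathrm{tFi}(\mathbf{A})$ is the poset of tense filters under inclusion. $C(\mathbf{A})$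 is the tense ICRDL-algebra on $C(A)=\{x\in A:x\ge c\}$ with $\vee,\wedge$ of $A$, product $x\cdot y=(x\ast y)\vee c$, $x\to y=\sim(x\ast(\sim y))$, bottom $c$, top $1$, and $G,H,F,P$ restricted from $A$; a tense filter of $C(\mathbf{A})$ is a nonempty up-set of $C(A)$ closed under $\cdot$, $G$ and $H$, and $\mathrm{tFi}(C(\mathbf{A}))$ is the poset of these under inclusion. -}

module Defs where

open import Level using (Level; suc; _⊔_)
open import Data.Product using (_×_; ∃)
open import Relation.Binary.PropositionalEquality using (_≡_)
open import Relation.Unary using (Pred)
open import Algebra.Core using (Op₁; Op₂)
open import Algebra.Lattice.Structures using (IsLattice)
open import Algebra.Structures using (IsCommutativeMonoid)

module DRLOps {a : Level} {Carrier : Set a}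
  (_∨_ _∧_ _∗_ : Op₂ Carrier) (∼ : Op₁ Carrier) (c 0# 1# : Carrier) (G H : Op₁ Carrier) where

  infix 4 _≤_
  _≤_ : Carrier → Carrier → Set a
  x ≤ y = x ∧ y ≡ x

  infixr 5 _⇒_
  _⇒_ : Op₂ Carrier
  x ⇒ y = ∼ (x ∗ ∼ y)

  F P : Op₁ Carrier
  F x = ∼ (G (∼ x))
  P x = ∼ (H (∼ x))

  record IsTenseDRL : Set a where
    field
      isLattice : IsLattice _≡_ _∨_ _∧_
      ∗-isCommutativeMonoid : IsCommutativeMonoid _≡_ _∗_ 1#
      0-bottom : ∀ x → 0# ≤ x
      1-top : ∀ x → x ≤ 1#
      residuation-⇒ : ∀ x y z → x ∗ y ≤ z → x ≤ y ⇒ z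
      residuation-⇐ : ∀ x y z → x ≤ y ⇒ z → x ∗ y ≤ z
      ∼-involutive : ∀ x → ∼ (∼ x) ≡ x
      ∼-∨ : ∀ x y → ∼ (x ∨ y) ≡ ∼ x ∧ ∼ y
      ∼-∧ : ∀ x y → ∼ (x ∧ y) ≡ ∼ x ∨ ∼ y
      ∼c : ∼ c ≡ c
      c-axiom : ∀ x y → (x ∗ y) ∧ c ≡ ((x ∧ c) ∗ y) ∨ (x ∗ (y ∧ c))
      t0-G : G 1# ≡ 1#
      t0-H : H 1# ≡ 1#
      t1-G : G c ≡ c
      t1-H : H c ≡ c
      t2-G : ∀ x y → G (x ∧ y) ≡ G x ∧ G y
      t2-H : ∀ x y → H (x ∧ y) ≡ H x ∧ H y
      t3-GP : ∀ x → x ≤ G (P x)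
      t3-HF : ∀ x → x ≤ H (F x)
      t4-G : ∀ x y → G (x ∨ y) ≤ G x ∨ F y
      t4-H : ∀ x y → H (x ∨ y) ≤ H x ∨ P y
      t5-G : ∀ x y → G (x ⇒ y) ≤ G x ⇒ G y
      t5-H : ∀ x y → H (x ⇒ y) ≤ H x ⇒ H y

record TenseDRL (a : Level) : Set (suc a) where
  field
    Carrier : Set a
    _∨_ _∧_ _∗_ : Op₂ Carrier
    ∼ : Op₁ Carrier
    c 0# 1# : Carrier
    G H : Op₁ Carrier
    isTenseDRL : DRLOps.IsTenseDRL _∨_ _∧_ _∗_ ∼ c 0# 1# G H

  open DRLOps _∨_ _∧_ _∗_ ∼ c 0# 1# G H public
  open IsTenseDRL isTenseDRL public

  -- C(A) = { x : c ≤ x }, product x · y = (x ∗ y) ∨ c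
  _·_ : Op₂ Carrier
  x · y = (x ∗ y) ∨ c

  record IsTenseFilter (D : Pred Carrier a) : Set a where
    field
      nonempty : ∃ D
      upset : ∀ {x y} → D x → x ≤ y → D y
      ∗-closed : ∀ {x y} → D x → D y → D (x ∗ y)
      G-closed : ∀ {x} → D x → D (G x)
      H-closed : ∀ {x} → D x → D (H x)

  record IsCTenseFilter (S : Pred Carrier a) : Set a where
    field
      ⊆C : ∀ {x} → S x → c ≤ x
      nonempty : ∃ S
      upset : ∀ {x y} → S x → x ≤ y → S y
      ·-closed : ∀ {x y} → S x → S y → S (x · y)
      G-closed : ∀ {x} → S x → S (G x)
      H-closed : ∀ {x} → S x → S (H x)

  S[_] : Pred Carrier a → Pred Carrier a
  S[ D ] x = D x × (c ≤ x)

  D[_] : Pred Carrier a → Pred Carrier a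
  D[ S ] u = S (u ∨ c) × S (c ⇒ u)

{-# OPTIONS --safe #-}
-- Every u ∈ A is recovered from its two "shadows" u ∨ c and c ⇒ u in C(A), since
-- (u ∨ c) ∗ (c ⇒ u) ≤ u; an element x ≥ c has the shadows x ∨ c = x and c ⇒ x = 1
-- (because c ∗ c = 0), so nothing is lost on C(A) either. The remaining work is to check that the shadows
-- of a product and of G u, H u are bounded by the corresponding operations on the
-- shadows, so that D_S is again a tense filter.
module Submission where

open import Defs
open import Level using (Level)
open import Data.Product using (_×_; _,_; proj₁; proj₂)
open import Function using (_∘_)
open import Relation.Unary using (Pred; _⊆_; _≐_)
open import Relation.Binary.PropositionalEquality
  using (_≡_; refl; sym; trans; cong; cong₂; subst; subst₂; isEquivalence)
open import Relation.Binary.Bundles using (Poset)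
open import Algebra.Core using (Op₁)
open import Algebra.Lattice.Bundles using (Lattice)
open import Algebra.Structures using (IsCommutativeMonoid)
import Algebra.Lattice.Properties.Lattice as LatticeProperties
import Relation.Binary.Lattice as OrderLattice
import Relation.Binary.Reasoning.PartialOrder as PosetReasoning

module TenseDRLProperties {a : Level} (𝔸 : TenseDRL a) where
  open TenseDRL 𝔸
  open IsCommutativeMonoid ∗-isCommutativeMonoid
    using () renaming (assoc to ∗-assoc; comm to ∗-comm; identityˡ to ∗-identityˡ; identityʳ to ∗-identityʳ)

  lattice : Lattice a a
  lattice = record { Carrier = Carrier ; _≈_ = _≡_ ; _∨_ = _∨_ ; _∧_ = _∧_ ; isLattice = isLattice }

  -- The library orders a lattice by x ≡ x ∧ y, the symmetric form of the order x ∧ y ≡ x used here.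
  private
    module L = OrderLattice.Lattice (LatticeProperties.∨-∧-orderTheoreticLattice lattice)

  ≤-refl : ∀ {x} → x ≤ x
  ≤-refl = sym L.refl

  ≡⇒≤ : ∀ {x y} → x ≡ y → x ≤ y
  ≡⇒≤ refl = ≤-refl

  ≤-trans : ∀ {x y z} → x ≤ y → y ≤ z → x ≤ z
  ≤-trans p q = sym (L.trans (sym p) (sym q))

  ≤-antisym : ∀ {x y} → x ≤ y → y ≤ x → x ≡ y
  ≤-antisym p q = L.antisym (sym p) (sym q)

  x≤x∨y : ∀ x y → x ≤ x ∨ y
  x≤x∨y x y = sym (L.x≤x∨y x y)

  y≤x∨y : ∀ x y → y ≤ x ∨ y
  y≤x∨y x y = sym (L.y≤x∨y x y)

  ∨-least : ∀ {x y z} → x ≤ z → y ≤ z → x ∨ y ≤ z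
  ∨-least p q = sym (L.∨-least (sym p) (sym q))

  ∨-mono : ∀ {x y u v} → x ≤ u → y ≤ v → x ∨ y ≤ u ∨ v
  ∨-mono {u = u} {v} p q = ∨-least (≤-trans p (x≤x∨y u v)) (≤-trans q (y≤x∨y u v))

  ≤⇒∨≡ : ∀ {x y} → x ≤ y → x ∨ y ≡ y
  ≤⇒∨≡ {x} {y} p = ≤-antisym (∨-least p ≤-refl) (y≤x∨y x y)

  poset : Poset a a a
  poset = record
    { _≈_ = _≡_
    ; _≤_ = _≤_
    ; isPartialOrder = record
      { isPreorder = record { isEquivalence = isEquivalence ; reflexive = ≡⇒≤ ; trans = ≤-trans }
      ; antisym = ≤-antisym
      }
    }

  open PosetReasoning poset

  ∼-antitone : ∀ {x y} → x ≤ y → ∼ y ≤ ∼ x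
  ∼-antitone {x} {y} p = subst (∼ y ≤_) ∼y∨∼x≡∼x (y≤x∨y (∼ x) (∼ y))
    where
    ∼y∨∼x≡∼x : ∼ x ∨ ∼ y ≡ ∼ x
    ∼y∨∼x≡∼x = trans (sym (∼-∧ x y)) (cong ∼ p)

  ∗-monoˡ : ∀ {x y} z → x ≤ y → x ∗ z ≤ y ∗ z
  ∗-monoˡ {x} {y} z p = residuation-⇐ x z (y ∗ z) (≤-trans p (residuation-⇒ y z (y ∗ z) ≤-refl))

  ∗-monoʳ : ∀ {x y} z → x ≤ y → z ∗ x ≤ z ∗ y
  ∗-monoʳ {x} {y} z p = subst₂ _≤_ (∗-comm x z) (∗-comm y z) (∗-monoˡ z p)

  ⇒-monoʳ : ∀ {y z} x → y ≤ z → x ⇒ y ≤ x ⇒ z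
  ⇒-monoʳ x = ∼-antitone ∘ ∗-monoʳ x ∘ ∼-antitone

  ∗-distribʳ-∨ : ∀ x y z → (x ∨ y) ∗ z ≤ (x ∗ z) ∨ (y ∗ z)
  ∗-distribʳ-∨ x y z = residuation-⇐ (x ∨ y) z _ (∨-least
    (residuation-⇒ x z _ (x≤x∨y (x ∗ z) (y ∗ z)))
    (residuation-⇒ y z _ (y≤x∨y (x ∗ z) (y ∗ z))))

  ∗-distribˡ-∨ : ∀ x y z → z ∗ (x ∨ y) ≤ (z ∗ x) ∨ (z ∗ y)
  ∗-distribˡ-∨ x y z =
    subst₂ _≤_ (∗-comm (x ∨ y) z) (cong₂ _∨_ (∗-comm x z) (∗-comm y z)) (∗-distribʳ-∨ x y z)

  x∗y≤x : ∀ x y → x ∗ y ≤ x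
  x∗y≤x x y = subst (x ∗ y ≤_) (∗-identityʳ x) (∗-monoʳ x (1-top y))

  x∗y≤y : ∀ x y → x ∗ y ≤ y
  x∗y≤y x y = subst (_≤ y) (∗-comm y x) (x∗y≤x y x)

  x∗[x⇒y]≤y : ∀ x y → x ∗ (x ⇒ y) ≤ y
  x∗[x⇒y]≤y x y = subst (_≤ y) (∗-comm (x ⇒ y) x) (residuation-⇐ (x ⇒ y) x y ≤-refl)

  ∼0≡1 : ∼ 0# ≡ 1#
  ∼0≡1 = ≤-antisym (1-top (∼ 0#)) (subst (_≤ ∼ 0#) (∼-involutive 1#) (∼-antitone (0-bottom (∼ 1#))))

  c⇒0≡c : c ⇒ 0# ≡ c
  c⇒0≡c = begin-equality
    ∼ (c ∗ ∼ 0#)  ≡⟨ cong (λ t → ∼ (c ∗ t)) ∼0≡1 ⟩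
    ∼ (c ∗ 1#)    ≡⟨ cong ∼ (∗-identityʳ c) ⟩
    ∼ c           ≡⟨ ∼c ⟩
    c             ∎

  c∗c≤0 : c ∗ c ≤ 0#
  c∗c≤0 = residuation-⇐ c c 0# (≡⇒≤ (sym c⇒0≡c))

  infixl 30 _⁺ _⁻
  _⁺ _⁻ : Op₁ Carrier
  u ⁺ = u ∨ c
  u ⁻ = c ⇒ u

  c≤⁺ : ∀ u → c ≤ u ⁺
  c≤⁺ u = y≤x∨y u c

  c≤⁻ : ∀ u → c ≤ u ⁻
  c≤⁻ u = residuation-⇒ c c u (≤-trans c∗c≤0 (0-bottom u))

  ≤⁻ : ∀ u → u ≤ u ⁻
  ≤⁻ u = residuation-⇒ u c u (x∗y≤x u c)

  c≤⇒⁻≡1 : ∀ {x} → c ≤ x → x ⁻ ≡ 1#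
  c≤⇒⁻≡1 {x} p = ≤-antisym (1-top (x ⁻)) (residuation-⇒ 1# c x (subst (_≤ x) (sym (∗-identityˡ c)) p))

  c≤⇒⁺≡id : ∀ {x} → c ≤ x → x ⁺ ≡ x
  c≤⇒⁺≡id {x} p = trans (∨-comm x c) (≤⇒∨≡ p)
    where open Lattice lattice using (∨-comm)

  ⁺∗⁻≤id : ∀ u → u ⁺ ∗ u ⁻ ≤ u
  ⁺∗⁻≤id u = begin
    (u ∨ c) ∗ (c ⇒ u)             ≤⟨ ∗-distribʳ-∨ u c (c ⇒ u) ⟩
    (u ∗ (c ⇒ u)) ∨ (c ∗ (c ⇒ u))  ≤⟨ ∨-least (x∗y≤x u (c ⇒ u)) (x∗[x⇒y]≤y c u) ⟩
    u                             ∎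

  ⁺·⁺≤[∗]⁺ : ∀ u v → u ⁺ · v ⁺ ≤ (u ∗ v) ⁺
  ⁺·⁺≤[∗]⁺ u v = ∨-least ⁺∗⁺≤[∗]⁺ (c≤⁺ (u ∗ v))
    where
    ⁺∗⁺≤[∗]⁺ : u ⁺ ∗ v ⁺ ≤ (u ∗ v) ⁺
    ⁺∗⁺≤[∗]⁺ = begin
      (u ∨ c) ∗ (v ∨ c)                        ≤⟨ ∗-distribʳ-∨ u c (v ∨ c) ⟩
      (u ∗ (v ∨ c)) ∨ (c ∗ (v ∨ c))             ≤⟨ ∨-mono (∗-distribˡ-∨ v c u) (x∗y≤x c (v ∨ c)) ⟩
      ((u ∗ v) ∨ (u ∗ c)) ∨ c                   ≤⟨ ∨-least (∨-mono ≤-refl (x∗y≤y u c)) (c≤⁺ (u ∗ v)) ⟩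
      (u ∗ v) ∨ c                               ∎

  ⁻·⁺≤[∗]⁻ : ∀ u v → u ⁻ · v ⁺ ≤ (u ∗ v) ⁻
  ⁻·⁺≤[∗]⁻ u v = ∨-least (residuation-⇒ (u ⁻ ∗ v ⁺) c (u ∗ v) ⁻∗⁺∗c≤∗) (c≤⁻ (u ∗ v))
    where
    ⁻∗⁺∗c≤∗ : (u ⁻ ∗ v ⁺) ∗ c ≤ u ∗ v
    ⁻∗⁺∗c≤∗ = begin
      ((c ⇒ u) ∗ (v ∨ c)) ∗ c                  ≡⟨ ∗-comm ((c ⇒ u) ∗ (v ∨ c)) c ⟩
      c ∗ ((c ⇒ u) ∗ (v ∨ c))                  ≡⟨ ∗-assoc c (c ⇒ u) (v ∨ c) ⟨
      (c ∗ (c ⇒ u)) ∗ (v ∨ c)                  ≤⟨ ∗-distribˡ-∨ v c (c ∗ (c ⇒ u)) ⟩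
      ((c ∗ (c ⇒ u)) ∗ v) ∨ ((c ∗ (c ⇒ u)) ∗ c) ≤⟨ ∨-least (∗-monoˡ v (x∗[x⇒y]≤y c u)) cu∗c≤u∗v ⟩
      u ∗ v                                    ∎
      where
      cu∗c≤u∗v : (c ∗ (c ⇒ u)) ∗ c ≤ u ∗ v
      cu∗c≤u∗v = ≤-trans (∗-monoˡ c (x∗y≤x c (c ⇒ u))) (≤-trans c∗c≤0 (0-bottom (u ∗ v)))

  -- Axioms (t1), (t2), (t4), (t5) of G or of H: all the correspondence needs of either operator.
  record IsTenseOperator (T : Op₁ Carrier) : Set a where
    field
      T-∧ : ∀ x y → T (x ∧ y) ≡ T x ∧ T y
      T-c : T c ≡ c
      T-∨ : ∀ x y → T (x ∨ y) ≤ T x ∨ ∼ (T (∼ y))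
      T-⇒ : ∀ x y → T (x ⇒ y) ≤ T x ⇒ T y

    T-mono : ∀ {x y} → x ≤ y → T x ≤ T y
    T-mono {x} {y} p = trans (sym (T-∧ x y)) (cong T p)

    c≤⇒c≤T : ∀ {x} → c ≤ x → c ≤ T x
    c≤⇒c≤T p = subst (_≤ _) T-c (T-mono p)

    T⁺≤⁺T : ∀ u → T (u ⁺) ≤ (T u) ⁺
    T⁺≤⁺T u = subst (λ t → T (u ∨ c) ≤ T u ∨ t) dual-c (T-∨ u c)
      where
      dual-c : ∼ (T (∼ c)) ≡ c
      dual-c = trans (cong (∼ ∘ T) ∼c) (trans (cong ∼ T-c) ∼c)

    T⁻≤⁻T : ∀ u → T (u ⁻) ≤ (T u) ⁻
    T⁻≤⁻T u = subst (λ t → T (c ⇒ u) ≤ t ⇒ T u) T-c (T-⇒ c u)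

  G-isTenseOperator : IsTenseOperator G
  G-isTenseOperator = record { T-∧ = t2-G ; T-c = t1-G ; T-∨ = t4-G ; T-⇒ = t5-G }

  H-isTenseOperator : IsTenseOperator H
  H-isTenseOperator = record { T-∧ = t2-H ; T-c = t1-H ; T-∨ = t4-H ; T-⇒ = t5-H }

  module G = IsTenseOperator G-isTenseOperator
  module H = IsTenseOperator H-isTenseOperator

  1∈tenseFilter : ∀ {D} → IsTenseFilter D → D 1#
  1∈tenseFilter fD = upset (proj₂ nonempty) (1-top _)
    where open IsTenseFilter fD

  1∈CTenseFilter : ∀ {S} → IsCTenseFilter S → S 1#
  1∈CTenseFilter fS = upset (proj₂ nonempty) (1-top _)
    where open IsCTenseFilter fS

  S[]-isCTenseFilter : ∀ {D} → IsTenseFilter D → IsCTenseFilter S[ D ]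
  S[]-isCTenseFilter fD = record
    { ⊆C       = proj₂
    ; nonempty = 1# , 1∈tenseFilter fD , 1-top c
    ; upset    = λ (dx , cx) x≤y → upset dx x≤y , ≤-trans cx x≤y
    ; ·-closed = λ {x} {y} (dx , _) (dy , _) → upset (∗-closed dx dy) (x≤x∨y (x ∗ y) c) , c≤⁺ (x ∗ y)
    ; G-closed = λ (dx , cx) → G-closed dx , G.c≤⇒c≤T cx
    ; H-closed = λ (dx , cx) → H-closed dx , H.c≤⇒c≤T cx
    }
    where open IsTenseFilter fD

  D[]-isTenseFilter : ∀ {S} → IsCTenseFilter S → IsTenseFilter D[ S ]
  D[]-isTenseFilter {S} fS = record
    { nonempty = 1# , upset one (x≤x∨y 1# c) , upset one (≡⇒≤ (sym (c≤⇒⁻≡1 (1-top c))))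
    ; upset    = λ (u⁺∈S , u⁻∈S) u≤v → upset u⁺∈S (∨-mono u≤v ≤-refl) , upset u⁻∈S (⇒-monoʳ c u≤v)
    ; ∗-closed = λ {u} {v} (u⁺∈S , u⁻∈S) (v⁺∈S , _) →
        upset (·-closed u⁺∈S v⁺∈S) (⁺·⁺≤[∗]⁺ u v) , upset (·-closed u⁻∈S v⁺∈S) (⁻·⁺≤[∗]⁻ u v)
    ; G-closed = λ {u} (u⁺∈S , u⁻∈S) → upset (G-closed u⁺∈S) (G.T⁺≤⁺T u) , upset (G-closed u⁻∈S) (G.T⁻≤⁻T u)
    ; H-closed = λ {u} (u⁺∈S , u⁻∈S) → upset (H-closed u⁺∈S) (H.T⁺≤⁺T u) , upset (H-closed u⁻∈S) (H.T⁻≤⁻T u)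
    }
    where
    open IsCTenseFilter fS
    one : S 1#
    one = 1∈CTenseFilter fS

  S[]-mono : ∀ {D D′ : Pred Carrier a} → D ⊆ D′ → S[ D ] ⊆ S[ D′ ]
  S[]-mono D⊆D′ (dx , cx) = D⊆D′ dx , cx

  D[]-mono : ∀ {S S′ : Pred Carrier a} → S ⊆ S′ → D[ S ] ⊆ D[ S′ ]
  D[]-mono S⊆S′ (u⁺∈S , u⁻∈S) = S⊆S′ u⁺∈S , S⊆S′ u⁻∈S

  D[S[]]≐id : ∀ {D} → IsTenseFilter D → D[ S[ D ] ] ≐ D
  D[S[]]≐id {D} fD = (λ {u} ((u⁺∈D , _) , (u⁻∈D , _)) → upset (∗-closed u⁺∈D u⁻∈D) (⁺∗⁻≤id u))
                   , (λ {u} u∈D → (upset u∈D (x≤x∨y u c) , c≤⁺ u) , (upset u∈D (≤⁻ u) , c≤⁻ u))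
    where open IsTenseFilter fD

  S[D[]]≐id : ∀ {S} → IsCTenseFilter S → S[ D[ S ] ] ≐ S
  S[D[]]≐id {S} fS = (λ ((x⁺∈S , _) , c≤x) → subst S (c≤⇒⁺≡id c≤x) x⁺∈S)
                   , (λ x∈S → let c≤x = ⊆C x∈S in
                        (subst S (sym (c≤⇒⁺≡id c≤x)) x∈S , subst S (sym (c≤⇒⁻≡1 c≤x)) (1∈CTenseFilter fS)) , c≤x)
    where open IsCTenseFilter fS

mainTheorem18 : ∀ {a : Level} (𝔸 : TenseDRL a) → let open TenseDRL 𝔸 in
    ((D : Pred Carrier a) → IsTenseFilter D → IsCTenseFilter S[ D ])
    × ((S : Pred Carrier a) → IsCTenseFilter S → IsTenseFilter D[ S ])
    × ((D D′ : Pred Carrier a) → IsTenseFilter D → IsTenseFilter D′ → D ⊆ D′ → S[ D ] ⊆ S[ D′ ])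
    × ((S S′ : Pred Carrier a) → IsCTenseFilter S → IsCTenseFilter S′ → S ⊆ S′ → D[ S ] ⊆ D[ S′ ])
    × ((D : Pred Carrier a) → IsTenseFilter D → D[ S[ D ] ] ≐ D)
    × ((S : Pred Carrier a) → IsCTenseFilter S → S[ D[ S ] ] ≐ S)
mainTheorem18 𝔸 =
    (λ _ → S[]-isCTenseFilter)
  , (λ _ → D[]-isTenseFilter)
  , (λ _ _ _ _ → S[]-mono)
  , (λ _ _ _ _ → D[]-mono)
  , (λ _ → D[S[]]≐id)
  , (λ _ → S[D[]]≐id)
  where open TenseDRLProperties 𝔸
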